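{- For integers $1 \leq j \leq k \leq n$, \[ r(n,j,\{k\}) = F(n+1-j,k,1) - F(n+1-2j,k,1). \]
   Context: A composition of $n$ is a finite sequence of positive integers summing to $n$. A run in a composition is a maximal block of consecutive equal parts; it is a run of $j$ if its parts equal $j$. $r(n,j,\{k\})$ is the total number of runs of $j$ (of any length) over all compositions of $n$ whose parts are all at most $k$. For $k\ge 1$: $F(n,k)=0$ for $n\le0$, $F(1,k)=1$, $F(n,k)=\sum_{i=1}^kF(n-i,k)$ for $n\ge2$. For $r\ge0$, $F(n+1,k,r)$ is the coefficient of $x^n$ in $\left(\sum_{i\ge0}F(i+1,k)x^i\right)^{r+1}$ for $n\ge0$, and $F(n,k,r)=0$ for $n\le 0$. -}

module Defs where

open import Data.Nat using (ℕ; zero; suc; _+_; _*_; _∸_; _≤_; _≤?_; _≟_)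
open import Data.List using (List; []; _∷_; map; concatMap; upTo; take; filter)
open import Data.Nat.ListAction using (sum)
open import Data.Bool using (if_then_else_)
open import Relation.Nullary.Decidable using (does)

-- compsAux k f n : all compositions of n with parts in {1,…,k}
-- (f is fuel; with f = n the enumeration is complete since each part ≥ 1).
compsAux : ℕ → ℕ → ℕ → List (List ℕ)
compsAux k f       zero    = [] ∷ []
compsAux k zero    (suc n) = []
compsAux k (suc f) (suc n) =
  concatMap (λ p → map (p ∷_) (compsAux k f (suc n ∸ p)))
            (filter (λ p → p ≤? suc n) (map suc (upTo k)))

compositions : ℕ → ℕ → List (List ℕ)
compositions n k = compsAux k n n

-- number of runs of j in a composition (maximal blocks of consecutive
-- parts equal to j) = number of positions holding j whose predecessor
-- is absent or different from j.  prev = 0 encodes "no predecessor"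
-- (parts are positive).
runsFrom : ℕ → ℕ → List ℕ → ℕ
runsFrom j prev [] = 0
runsFrom j prev (p ∷ ps) =
  (if does (p ≟ j) then (if does (prev ≟ j) then 0 else 1) else 0)
  + runsFrom j p ps

runs : ℕ → List ℕ → ℕ
runs j c = runsFrom j 0 c

r : ℕ → ℕ → ℕ → ℕ
r n j k = sum (map (runs j) (compositions n k))

-- table k m = [F(m,k), F(m-1,k), …, F(1,k)]
table : ℕ → ℕ → List ℕ
table k zero = []
table k (suc zero) = 1 ∷ []
table k (suc (suc m)) = sum (take k (table k (suc m))) ∷ table k (suc m)

-- F k m = F(m,k) for m ≥ 0 (F(0,k) = 0); negative arguments are
-- handled by truncated subtraction at use sites (value 0 there).
F : ℕ → ℕ → ℕ
F k zero = 0
F k (suc m) with table k (suc m)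
... | [] = 0
... | x ∷ _ = x

-- coefficient of x^n in (Σ_{i≥0} F(i+1,k) x^i)^(r+1)
coef : ℕ → ℕ → ℕ → ℕ
coef k zero    n = F k (suc n)
coef k (suc r) n = sum (map (λ i → F k (suc i) * coef k r (n ∸ i)) (upTo (suc n)))

-- F3 k r m = F(m,k,r) ; F(m,k,r) = 0 for m ≤ 0
F3 : ℕ → ℕ → ℕ → ℕ
F3 k r zero = 0
F3 k r (suc n) = coef k r n

module Submission where

-- We work with integer sequences ℕ → ℤ as formal power series: shift d
-- multiplies by x^d, conv multiplies two series, and lag k f is
-- (x + x² + … + x^k) · f.  A sequence solving f = lag k f + g is uniquely
-- determined by g (recurrence-unique), so every identity below is proved by
-- showing that both sides satisfy the same k-bonacci recurrence.
--
-- Splitting a composition after its first part gives such recurrences for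
--   count n, the number of compositions of n (solved by F(n+1,k)),
--   A n,     the number of runs of j (counted from the start), and
--   B n,     the same count but as if a part j preceded the composition.
-- From A = lag A + x^j (count + B - A) and B = lag A + x^j (B - A) we get
-- A - B = x^j count and hence A = lag A + (x^j - x^{2j}) count.  The square
-- fib² of the series Σ F(i+1,k) x^i satisfies fib² = lag fib² + count, so
-- (x^j - x^{2j}) fib² solves the same recurrence as A; its n-th coefficient
-- is exactly F(n+1-j,k,1) - F(n+1-2j,k,1).

open import Defs
open import Data.Nat using (ℕ; suc; _≤_)

module Sequences where

  open import Data.Nat as ℕ using (zero; _∸_; _<_; _≤?_; _≟_; z≤n; s≤s)
  import Data.Nat.Properties as ℕP
  open import Data.Nat.Induction using (<-rec)
  open import Data.Integer using (ℤ; 0ℤ; 1ℤ; _+_; _-_; _*_)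
  import Data.Integer.Properties as ℤP
  open import Data.Integer.Tactic.RingSolver using (solve-∀)
  open import Data.Empty using (⊥-elim)
  open import Relation.Nullary using (yes; no; ¬_)
  open import Relation.Binary.PropositionalEquality
    using (_≡_; refl; sym; trans; cong; cong₂; subst)

  Σ< : ℕ → (ℕ → ℤ) → ℤ
  Σ< zero    f = 0ℤ
  Σ< (suc n) f = f 0 + Σ< n (λ i → f (suc i))

  Σ<-cong : ∀ n {f g : ℕ → ℤ} → (∀ i → i < n → f i ≡ g i) → Σ< n f ≡ Σ< n g
  Σ<-cong zero    eq = refl
  Σ<-cong (suc n) eq =
    cong₂ _+_ (eq 0 (s≤s z≤n)) (Σ<-cong n (λ i i<n → eq (suc i) (s≤s i<n)))

  Σ<-zero : ∀ n (f : ℕ → ℤ) → (∀ i → i < n → f i ≡ 0ℤ) → Σ< n f ≡ 0ℤ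
  Σ<-zero zero    f eq = refl
  Σ<-zero (suc n) f eq =
    cong₂ _+_ (eq 0 (s≤s z≤n)) (Σ<-zero n _ (λ i i<n → eq (suc i) (s≤s i<n)))

  Σ<-+ : ∀ n (f g : ℕ → ℤ) → Σ< n (λ i → f i + g i) ≡ Σ< n f + Σ< n g
  Σ<-+ zero    f g = refl
  Σ<-+ (suc n) f g =
    trans (cong (f 0 + g 0 +_) (Σ<-+ n _ _)) (interchange (f 0) (g 0) _ _)
    where
    interchange : ∀ a b c d → a + b + (c + d) ≡ a + c + (b + d)
    interchange = solve-∀

  Σ<-- : ∀ n (f g : ℕ → ℤ) → Σ< n (λ i → f i - g i) ≡ Σ< n f - Σ< n g
  Σ<-- zero    f g = refl
  Σ<-- (suc n) f g =
    trans (cong (f 0 - g 0 +_) (Σ<-- n _ _)) (interchange (f 0) (g 0) _ _)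
    where
    interchange : ∀ a b c d → a - b + (c - d) ≡ a + c - (b + d)
    interchange = solve-∀

  Σ<-*ʳ : ∀ n (f : ℕ → ℤ) c → Σ< n (λ i → f i * c) ≡ Σ< n f * c
  Σ<-*ʳ zero    f c = refl
  Σ<-*ʳ (suc n) f c =
    trans (cong (f 0 * c +_) (Σ<-*ʳ n _ c)) (sym (ℤP.*-distribʳ-+ c (f 0) _))

  Σ<-swap : ∀ a b (h : ℕ → ℕ → ℤ) →
            Σ< a (λ i → Σ< b (h i)) ≡ Σ< b (λ q → Σ< a (λ i → h i q))
  Σ<-swap zero    b h = sym (Σ<-zero b _ (λ _ _ → refl))
  Σ<-swap (suc a) b h =
    trans (cong (Σ< b (h 0) +_) (Σ<-swap a b (λ i → h (suc i))))
          (sym (Σ<-+ b (h 0) _))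

  Σ<-dropZeros : ∀ p n (f : ℕ → ℤ) → (∀ i → i < p → f i ≡ 0ℤ) →
                 Σ< (p ℕ.+ n) f ≡ Σ< n (λ i → f (p ℕ.+ i))
  Σ<-dropZeros zero    n f eq = refl
  Σ<-dropZeros (suc p) n f eq =
    trans (cong₂ _+_ (eq 0 (s≤s z≤n))
                     (Σ<-dropZeros p n _ (λ i i<p → eq (suc i) (s≤s i<p))))
          (ℤP.+-identityˡ _)

  onlyAt : ℕ → ℕ → ℤ → ℤ
  onlyAt t q x with q ≟ t
  ... | yes _ = x
  ... | no  _ = 0ℤ

  onlyAt-suc : ∀ t q x → onlyAt (suc t) (suc q) x ≡ onlyAt t q x
  onlyAt-suc t q x with q ≟ t | suc q ≟ suc t
  ... | yes _   | yes _    = refl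
  ... | no  _   | no  _    = refl
  ... | yes q≡t | no  q≢t  = ⊥-elim (q≢t (cong suc q≡t))
  ... | no  q≢t | yes q≡t  = ⊥-elim (q≢t (ℕP.suc-injective q≡t))

  Σ<-onlyAt : ∀ k t x → t < k → Σ< k (λ q → onlyAt t q x) ≡ x
  Σ<-onlyAt (suc k) zero    x _ =
    trans (cong (x +_) (Σ<-zero k _ (λ _ _ → refl))) (ℤP.+-identityʳ x)
  Σ<-onlyAt (suc k) (suc t) x (s≤s t<k) =
    trans (ℤP.+-identityˡ _)
    (trans (Σ<-cong k (λ q _ → onlyAt-suc t q x)) (Σ<-onlyAt k t x t<k))

  cut : ℕ → ℕ → ℤ → ℤ
  cut d m x with d ≤? m
  ... | yes _ = x
  ... | no  _ = 0ℤ

  cut-yes : ∀ {d m} x → d ≤ m → cut d m x ≡ x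
  cut-yes {d} {m} x d≤m with d ≤? m
  ... | yes _   = refl
  ... | no  d≰m = ⊥-elim (d≰m d≤m)

  cut-no : ∀ {d m} x → ¬ d ≤ m → cut d m x ≡ 0ℤ
  cut-no {d} {m} x d≰m with d ≤? m
  ... | yes d≤m = ⊥-elim (d≰m d≤m)
  ... | no  _   = refl

  cut-+ : ∀ d m x y → cut d m (x + y) ≡ cut d m x + cut d m y
  cut-+ d m x y with d ≤? m
  ... | yes _ = refl
  ... | no  _ = refl

  cut-- : ∀ d m x y → cut d m (x - y) ≡ cut d m x - cut d m y
  cut-- d m x y with d ≤? m
  ... | yes _ = refl
  ... | no  _ = refl

  cut-Σ : ∀ d m a (h : ℕ → ℤ) → cut d m (Σ< a h) ≡ Σ< a (λ q → cut d m (h q))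
  cut-Σ d m a h with d ≤? m
  ... | yes _ = refl
  ... | no  _ = sym (Σ<-zero a _ (λ _ _ → refl))

  -- The sequence f delayed by d steps: shift d f m = f (m - d), and 0 for m < d.
  -- In generating-function terms this is multiplication by x^d.
  shift : ℕ → (ℕ → ℤ) → ℕ → ℤ
  shift d f m = cut d m (f (m ∸ d))

  shift-cong : ∀ d {f g : ℕ → ℤ} m → (∀ i → f i ≡ g i) → shift d f m ≡ shift d g m
  shift-cong d m eq = cong (cut d m) (eq (m ∸ d))

  shift-shift : ∀ d p (f : ℕ → ℤ) m → shift d (shift p f) m ≡ shift (d ℕ.+ p) f m
  shift-shift d p f m with d ≤? m
  ... | no d≰m = sym (cut-no _ (λ d+p≤m → d≰m (ℕP.m+n≤o⇒m≤o d d+p≤m)))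
  ... | yes d≤m with p ≤? m ∸ d
  ...   | yes p≤m∸d = sym (trans (cut-yes _ d+p≤m) (cong f (sym (ℕP.∸-+-assoc m d p))))
    where
    d+p≤m : d ℕ.+ p ≤ m
    d+p≤m = subst (d ℕ.+ p ≤_) (ℕP.m+[n∸m]≡n d≤m) (ℕP.+-monoʳ-≤ d p≤m∸d)
  ...   | no p≰m∸d = sym (cut-no _ (λ d+p≤m →
            p≰m∸d (ℕP.m+n≤o⇒m≤o∸n p (subst (_≤ m) (ℕP.+-comm d p) d+p≤m))))

  -- The k-step lag: lag k f n = f (n-1) + f (n-2) + … + f (n-k), negative
  -- indices omitted.  "f = lag k f + g" is the k-bonacci recurrence with
  -- inhomogeneity g.
  lag : ℕ → (ℕ → ℤ) → ℕ → ℤ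
  lag k f n = Σ< k (λ q → shift (suc q) f n)

  lag-at-0 : ∀ k (f : ℕ → ℤ) → lag k f 0 ≡ 0ℤ
  lag-at-0 k f = Σ<-zero k _ (λ _ _ → refl)

  lag-local : ∀ k n (f g : ℕ → ℤ) → (∀ m → m < n → f m ≡ g m) → lag k f n ≡ lag k g n
  lag-local k n f g eq = Σ<-cong k (λ q _ → agree q)
    where
    agree : ∀ q → shift (suc q) f n ≡ shift (suc q) g n
    agree q with suc q ≤? n
    ... | no  _ = refl
    ... | yes (s≤s {n = n′} q≤n′) = eq (n′ ∸ q) (s≤s (ℕP.m∸n≤m n′ q))

  lag-- : ∀ k (f g : ℕ → ℤ) n → lag k (λ m → f m - g m) n ≡ lag k f n - lag k g n
  lag-- k f g n = trans (Σ<-cong k (λ q _ → cut-- (suc q) n _ _)) (Σ<-- k _ _)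

  shift-lag : ∀ k d (f : ℕ → ℤ) n → shift d (lag k f) n ≡ lag k (shift d f) n
  shift-lag k d f n = trans (cut-Σ d n k _) (Σ<-cong k (λ q _ → commute q))
    where
    commute : ∀ q → shift d (shift (suc q) f) n ≡ shift (suc q) (shift d f) n
    commute q = trans (shift-shift d (suc q) f n)
               (trans (cong (λ e → shift e f n) (ℕP.+-comm d (suc q)))
                      (sym (shift-shift (suc q) d f n)))

  -- A solution of f = lag k f + g is determined by g (strong induction,
  -- since lag only looks at earlier values).
  recurrence-unique : ∀ k (g f h : ℕ → ℤ) →
    (∀ n → f n ≡ lag k f n + g n) → (∀ n → h n ≡ lag k h n + g n) → ∀ n → f n ≡ h n
  recurrence-unique k g f h f-rec h-rec = <-rec _ step
    where
    step : ∀ n → (∀ {m} → m < n → f m ≡ h m) → f n ≡ h n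
    step n below = trans (f-rec n)
      (trans (cong (_+ g n) (lag-local k n f h (λ m m<n → below m<n))) (sym (h-rec n)))

  conv : (ℕ → ℤ) → (ℕ → ℤ) → ℕ → ℤ
  conv f g m = Σ< (suc m) (λ i → f i * g (m ∸ i))

  δ : ℕ → ℤ
  δ zero    = 1ℤ
  δ (suc _) = 0ℤ

  conv-congˡ : ∀ {f f′} (g : ℕ → ℤ) m → (∀ i → f i ≡ f′ i) → conv f g m ≡ conv f′ g m
  conv-congˡ g m eq = Σ<-cong (suc m) (λ i _ → cong (_* g (m ∸ i)) (eq i))

  conv-+ˡ : ∀ (f f′ g : ℕ → ℤ) m → conv (λ i → f i + f′ i) g m ≡ conv f g m + conv f′ g m
  conv-+ˡ f f′ g m =
    trans (Σ<-cong (suc m) (λ i _ → ℤP.*-distribʳ-+ (g (m ∸ i)) (f i) (f′ i)))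
          (Σ<-+ (suc m) (λ i → f i * g (m ∸ i)) (λ i → f′ i * g (m ∸ i)))

  conv-δ : ∀ (g : ℕ → ℤ) m → conv δ g m ≡ g m
  conv-δ g m =
    trans (cong₂ _+_ (ℤP.*-identityˡ (g m)) (Σ<-zero m _ (λ i _ → refl))) (ℤP.+-identityʳ (g m))

  conv-Σˡ : ∀ a (h : ℕ → ℕ → ℤ) (g : ℕ → ℤ) m →
            conv (λ i → Σ< a (λ q → h q i)) g m ≡ Σ< a (λ q → conv (h q) g m)
  conv-Σˡ a h g m =
    trans (Σ<-cong (suc m) (λ i _ → sym (Σ<-*ʳ a (λ q → h q i) (g (m ∸ i)))))
          (Σ<-swap (suc m) a (λ i q → h q i * g (m ∸ i)))

  conv-shiftˡ-above : ∀ p (f g : ℕ → ℤ) m′ → conv (shift p f) g (p ℕ.+ m′) ≡ conv f g m′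
  conv-shiftˡ-above p f g m′ =
    trans (cong (λ e → Σ< e term) (sym (ℕP.+-suc p m′)))
    (trans (Σ<-dropZeros p (suc m′) term (λ i i<p → cong (_* _) (cut-no _ (ℕP.<⇒≱ i<p))))
           (Σ<-cong (suc m′) (λ i _ → cong₂ _*_ (unshift i) (cong g (ℕP.[m+n]∸[m+o]≡n∸o p m′ i)))))
    where
    term : ℕ → ℤ
    term i = shift p f i * g (p ℕ.+ m′ ∸ i)
    unshift : ∀ i → shift p f (p ℕ.+ i) ≡ f i
    unshift i = trans (cut-yes _ (ℕP.m≤m+n p i)) (cong f (ℕP.m+n∸m≡n p i))

  conv-shiftˡ : ∀ p (f g : ℕ → ℤ) m → conv (shift p f) g m ≡ shift p (conv f g) m
  conv-shiftˡ p f g m with p ≤? m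
  ... | yes p≤m = subst (λ e → conv (shift p f) g e ≡ conv f g (e ∸ p)) (ℕP.m+[n∸m]≡n p≤m)
                    (trans (conv-shiftˡ-above p f g (m ∸ p))
                           (cong (conv f g) (sym (ℕP.m+n∸m≡n p (m ∸ p)))))
  ... | no p≰m  = Σ<-zero (suc m) (λ i → shift p f i * g (m ∸ i)) (λ i i≤m →
                    cong (_* _) (cut-no _ (λ p≤i → p≰m (ℕP.≤-trans p≤i (ℕP.≤-pred i≤m)))))

  conv-lagˡ : ∀ k (f g : ℕ → ℤ) m → conv (lag k f) g m ≡ lag k (conv f g) m
  conv-lagˡ k f g m =
    trans (conv-Σˡ k (λ q → shift (suc q) f) g m) (Σ<-cong k (λ q _ → conv-shiftˡ (suc q) f g m))

module CompositionTotals where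

  open Sequences
  open import Data.Nat as ℕ using (zero; _∸_; _≤?_; s≤s)
  import Data.Nat.Properties as ℕP
  open import Data.Nat.ListAction using (sum)
  open import Data.List using (List; []; _∷_; _++_; map; concatMap; filter; upTo; applyUpTo)
  import Data.List.Properties as ListP
  open import Data.Integer using (ℤ; 0ℤ; 1ℤ; +_; _+_)
  import Data.Integer.Properties as ℤP
  open import Data.Integer.Tactic.RingSolver using (solve-∀)
  open import Function using (_∘_)
  open import Relation.Nullary using (yes; no)
  open import Relation.Binary.PropositionalEquality using (_≡_; refl; sym; trans; cong; cong₂)
  open Relation.Binary.PropositionalEquality.≡-Reasoning

  total : (List ℕ → ℕ) → List (List ℕ) → ℤ
  total φ []       = 0ℤ
  total φ (c ∷ cs) = + φ c + total φ cs

  total-sum : ∀ φ cs → + sum (map φ cs) ≡ total φ cs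
  total-sum φ []       = refl
  total-sum φ (c ∷ cs) = trans (ℤP.pos-+ (φ c) _) (cong (_+_ (+ φ c)) (total-sum φ cs))

  +sum-applyUpTo : ∀ n (f h : ℕ → ℕ) → + sum (map h (applyUpTo f n)) ≡ Σ< n (λ i → + h (f i))
  +sum-applyUpTo zero    f h = refl
  +sum-applyUpTo (suc n) f h =
    trans (ℤP.pos-+ (h (f 0)) _) (cong (_+_ (+ h (f 0))) (+sum-applyUpTo n (λ i → f (suc i)) h))

  total-cong : ∀ {φ ψ} cs → (∀ c → φ c ≡ ψ c) → total φ cs ≡ total ψ cs
  total-cong []       eq = refl
  total-cong (c ∷ cs) eq = cong₂ (λ a b → + a + b) (eq c) (total-cong cs eq)

  total-++ : ∀ φ cs ds → total φ (cs ++ ds) ≡ total φ cs + total φ ds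
  total-++ φ []       ds = sym (ℤP.+-identityˡ _)
  total-++ φ (c ∷ cs) ds =
    trans (cong (_+_ (+ φ c)) (total-++ φ cs ds))
          (sym (ℤP.+-assoc (+ φ c) (total φ cs) (total φ ds)))

  total-prepend : ∀ φ p cs → total φ (map (p ∷_) cs) ≡ total (λ c → φ (p ∷ c)) cs
  total-prepend φ p []       = refl
  total-prepend φ p (c ∷ cs) = cong (_+_ (+ φ (p ∷ c))) (total-prepend φ p cs)

  total-suc : ∀ ψ cs → total (λ c → suc (ψ c)) cs ≡ total (λ _ → 1) cs + total ψ cs
  total-suc ψ []       = refl
  total-suc ψ (c ∷ cs) =
    trans (cong₂ _+_ (ℤP.pos-+ 1 (ψ c)) (total-suc ψ cs))
          (regroup (+ ψ c) (total (λ _ → 1) cs) (total ψ cs))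
    where
    regroup : ∀ a n s → 1ℤ + a + (n + s) ≡ 1ℤ + n + (a + s)
    regroup = solve-∀

  total-byParts : ∀ φ m (block : ℕ → List (List ℕ)) n (f : ℕ → ℕ) →
    total φ (concatMap block (filter (_≤? m) (map suc (applyUpTo f n))))
      ≡ Σ< n (λ q → cut (suc (f q)) m (total φ (block (suc (f q)))))
  total-byParts φ m block zero    f = refl
  total-byParts φ m block (suc n) f with suc (f 0) ≤? m
  ... | yes fits = trans (cong (total φ ∘ concatMap block) (ListP.filter-accept (_≤? m) fits))
    (trans (total-++ φ (block (suc (f 0))) _)
           (cong (_+_ (total φ (block (suc (f 0))))) (total-byParts φ m block n (λ i → f (suc i)))))
  ... | no  misses = trans (cong (total φ ∘ concatMap block) (ListP.filter-reject (_≤? m) misses))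
    (trans (total-byParts φ m block n (λ i → f (suc i))) (sym (ℤP.+-identityˡ _)))

  concatMap-fitting-cong : ∀ m (block block′ : ℕ → List (List ℕ)) ys →
    (∀ q → suc q ≤ m → block (suc q) ≡ block′ (suc q)) →
    concatMap block  (filter (_≤? m) (map suc ys))
      ≡ concatMap block′ (filter (_≤? m) (map suc ys))
  concatMap-fitting-cong m block block′ []       eq = refl
  concatMap-fitting-cong m block block′ (y ∷ ys) eq with suc y ≤? m
  ... | yes fits = begin
    concatMap block  (filter (_≤? m) (suc y ∷ map suc ys))
      ≡⟨ cong (concatMap block) (ListP.filter-accept (_≤? m) fits) ⟩
    block (suc y) ++ concatMap block (filter (_≤? m) (map suc ys))
      ≡⟨ cong₂ _++_ (eq y fits) (concatMap-fitting-cong m block block′ ys eq) ⟩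
    block′ (suc y) ++ concatMap block′ (filter (_≤? m) (map suc ys))
      ≡⟨ cong (concatMap block′) (ListP.filter-accept (_≤? m) fits) ⟨
    concatMap block′ (filter (_≤? m) (suc y ∷ map suc ys)) ∎
  ... | no  misses = begin
    concatMap block  (filter (_≤? m) (suc y ∷ map suc ys))
      ≡⟨ cong (concatMap block) (ListP.filter-reject (_≤? m) misses) ⟩
    concatMap block  (filter (_≤? m) (map suc ys))
      ≡⟨ concatMap-fitting-cong m block block′ ys eq ⟩
    concatMap block′ (filter (_≤? m) (map suc ys))
      ≡⟨ cong (concatMap block′) (ListP.filter-reject (_≤? m) misses) ⟨
    concatMap block′ (filter (_≤? m) (suc y ∷ map suc ys)) ∎

  compsAux-fuel : ∀ k f f′ n → n ≤ f → n ≤ f′ → compsAux k f n ≡ compsAux k f′ n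
  compsAux-fuel k f       f′       zero    _         _          = refl
  compsAux-fuel k (suc f) (suc f′) (suc n) (s≤s n≤f) (s≤s n≤f′) =
    concatMap-fitting-cong (suc n) _ _ (upTo k) (λ q _ → cong (map (suc q ∷_))
      (compsAux-fuel k f f′ (n ∸ q) (ℕP.≤-trans (ℕP.m∸n≤m n q) n≤f)
                                    (ℕP.≤-trans (ℕP.m∸n≤m n q) n≤f′)))

  compositions-unfold : ∀ k n → compositions (suc n) k ≡
    concatMap (λ p → map (p ∷_) (compositions (suc n ∸ p) k))
              (filter (λ p → p ≤? suc n) (map suc (upTo k)))
  compositions-unfold k n =
    concatMap-fitting-cong (suc n) _ _ (upTo k) (λ q _ → cong (map (suc q ∷_))
      (compsAux-fuel k n (n ∸ q) (n ∸ q) (ℕP.m∸n≤m n q) ℕP.≤-refl))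

  total-firstPart : ∀ k φ n → total φ (compositions (suc n) k) ≡
    Σ< k (λ q → shift (suc q) (λ m → total (λ c → φ (suc q ∷ c)) (compositions m k)) (suc n))
  total-firstPart k φ n =
    trans (cong (total φ) (compositions-unfold k n))
    (trans (total-byParts φ (suc n) _ k (λ i → i))
           (Σ<-cong k (λ q _ → cong (cut (suc q) (suc n))
                                    (total-prepend φ (suc q) (compositions (n ∸ q) k)))))

module KBonacci (k : ℕ) where

  open Sequences
  open CompositionTotals
  open import Data.Nat as ℕ using (zero; _∸_; _≤?_; s≤s)
  import Data.Nat.Properties as ℕP
  open import Data.Nat.ListAction using (sum)
  open import Data.List using (_∷_; take)
  open import Data.Integer using (ℤ; 1ℤ; +_; _+_)
  import Data.Integer.Properties as ℤP
  open import Relation.Nullary using (yes; no)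
  open import Relation.Binary.PropositionalEquality using (_≡_; refl; sym; trans; cong; cong₂; subst)

  fib : ℕ → ℤ
  fib m = + F k (suc m)

  table-head : ∀ m → table k (suc m) ≡ F k (suc m) ∷ table k m
  table-head zero    = refl
  table-head (suc m) = refl

  +sum-take-table : ∀ q m → + sum (take q (table k m)) ≡ Σ< q (λ i → + F k (m ∸ i))
  +sum-take-table zero    m       = refl
  +sum-take-table (suc q) zero    =
    sym (Σ<-zero (suc q) _ (λ i _ → cong (λ x → + F k x) (ℕP.0∸n≡0 i)))
  +sum-take-table (suc q) (suc m) =
    trans (cong (λ l → + sum (take (suc q) l)) (table-head m))
    (trans (ℤP.pos-+ (F k (suc m)) _) (cong (_+_ (fib m)) (+sum-take-table q m)))

  shift-fib : ∀ q m → shift (suc q) fib (suc m) ≡ + F k (suc m ∸ q)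
  shift-fib q m with suc q ≤? suc m
  ... | yes (s≤s q≤m) = cong (λ x → + F k x) (sym (ℕP.+-∸-assoc 1 q≤m))
  ... | no  q≰m       = cong (λ x → + F k x) (sym (ℕP.m≤n⇒m∸n≡0 (ℕP.≤-pred (ℕP.≰⇒> q≰m))))

  fib-rec : ∀ m → fib m ≡ lag k fib m + δ m
  fib-rec zero    = sym (cong (_+ 1ℤ) (lag-at-0 k fib))
  fib-rec (suc m) =
    trans (+sum-take-table k (suc m))
    (trans (sym (Σ<-cong k (λ q _ → shift-fib q m))) (sym (ℤP.+-identityʳ _)))

  -- Coefficients of (Σ F(i+1,k) x^i)^2; they satisfy the recurrence with
  -- inhomogeneity fib, because (1 - x - … - x^k) · fib = δ.
  fib² : ℕ → ℤ
  fib² = conv fib fib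

  fib²-rec : ∀ m → fib² m ≡ lag k fib² m + fib m
  fib²-rec m =
    trans (conv-congˡ fib m fib-rec)
    (trans (conv-+ˡ (lag k fib) δ fib m) (cong₂ _+_ (conv-lagˡ k fib fib m) (conv-δ fib m)))

  fib²≡F3 : ∀ m → fib² m ≡ + F3 k 1 (suc m)
  fib²≡F3 m =
    trans (Σ<-cong (suc m) (λ i _ → sym (ℤP.pos-* (F k (suc i)) (F k (suc (m ∸ i))))))
          (sym (+sum-applyUpTo (suc m) (λ i → i) (λ i → F k (suc i) ℕ.* F k (suc (m ∸ i)))))

  shift-fib² : ∀ d n → shift d fib² n ≡ + F3 k 1 (n ℕ.+ 1 ∸ d)
  shift-fib² d n with d ≤? n
  ... | yes d≤n = trans (fib²≡F3 (n ∸ d))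
                    (cong (λ x → + F3 k 1 x) (sym (trans (ℕP.+-∸-comm 1 d≤n) (ℕP.+-comm (n ∸ d) 1))))
  ... | no  d≰n = cong (λ x → + F3 k 1 x)
                    (sym (ℕP.m≤n⇒m∸n≡0 (subst (_≤ d) (ℕP.+-comm 1 n) (ℕP.≰⇒> d≰n))))

  count : ℕ → ℤ
  count m = total (λ _ → 1) (compositions m k)

  count-rec : ∀ m → count m ≡ lag k count m + δ m
  count-rec zero    = sym (cong (_+ 1ℤ) (lag-at-0 k count))
  count-rec (suc m) = trans (total-firstPart k (λ _ → 1) m) (sym (ℤP.+-identityʳ _))

  count≡fib : ∀ m → count m ≡ fib m
  count≡fib = recurrence-unique k δ count fib count-rec fib-rec

module RunsOfJ (k j′ : ℕ) (j≤k : suc j′ ≤ k) where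

  open Sequences
  open CompositionTotals
  open KBonacci k
  open import Data.Nat as ℕ using (zero; _≟_)
  import Data.Nat.Properties as ℕP
  open import Data.List using ([]; _∷_)
  open import Data.Integer using (ℤ; _+_; _-_)
  import Data.Integer.Properties as ℤP
  open import Data.Integer.Tactic.RingSolver using (solve-∀)
  open import Data.Empty using (⊥-elim)
  open import Data.Bool using (true; false; T)
  open import Data.Unit using (tt)
  open import Relation.Nullary using (yes; no; ¬_)
  open import Relation.Binary.PropositionalEquality using (_≡_; refl; sym; trans; cong; cong₂; subst)

  j : ℕ
  j = suc j′

  -- runsFrom tests "part = j" with the boolean p ≡ᵇ j.
  isJ-false : ∀ {p} → ¬ p ≡ j → (p ℕ.≡ᵇ j) ≡ false
  isJ-false {p} p≢j with p ℕ.≡ᵇ j in eq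
  ... | true  = ⊥-elim (p≢j (ℕP.≡ᵇ⇒≡ p j (subst T (sym eq) tt)))
  ... | false = refl

  isJ-true : (j ℕ.≡ᵇ j) ≡ true
  isJ-true with j ℕ.≡ᵇ j in eq
  ... | true  = refl
  ... | false = ⊥-elim (subst T eq (ℕP.≡⇒≡ᵇ j j refl))

  runs-forget : ∀ p c → ¬ p ≡ j → runsFrom j p c ≡ runsFrom j 0 c
  runs-forget p []      p≢j = refl
  runs-forget p (x ∷ c) p≢j rewrite isJ-false p≢j = refl

  runs-other : ∀ prev p c → ¬ p ≡ j → runsFrom j prev (p ∷ c) ≡ runsFrom j 0 c
  runs-other prev p c p≢j rewrite isJ-false p≢j = runs-forget p c p≢j

  runs-new : ∀ c → runsFrom j 0 (j ∷ c) ≡ suc (runsFrom j j c)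
  runs-new c rewrite isJ-true = refl

  runs-continue : ∀ c → runsFrom j j (j ∷ c) ≡ runsFrom j j c
  runs-continue c rewrite isJ-true = refl

  -- runTotal prev n: runs of j over all compositions of n, counted as if
  -- they were preceded by the part prev.  A = r(·, j, {k}); B: after a j.
  runTotal : ℕ → ℕ → ℤ
  runTotal prev n = total (runsFrom j prev) (compositions n k)

  A B : ℕ → ℤ
  A = runTotal 0
  B = runTotal j

  -- Splitting off the first part: a part other than j leaves a plain
  -- composition (contributing A shifted), the part j contributes A + Y
  -- shifted by j, where Y is whatever the first part j adds.
  runTotal-rec : ∀ prev (Y : ℕ → ℤ) →
    (∀ m → total (λ c → runsFrom j prev (j ∷ c)) (compositions m k) ≡ A m + Y m) →
    ∀ n → runTotal prev n ≡ lag k A n + shift j Y n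
  runTotal-rec prev Y first-j zero =
    sym (cong₂ _+_ (lag-at-0 k A) (cut-no {j} {0} (Y 0) (λ ())))
  runTotal-rec prev Y first-j (suc n) =
    trans (total-firstPart k (runsFrom j prev) n)
    (trans (Σ<-cong k (λ q _ → byFirstPart q))
    (trans (Σ<-+ k (λ q → shift (suc q) A (suc n)) (λ q → onlyAt j′ q (shift j Y (suc n))))
           (cong (lag k A (suc n) +_) (Σ<-onlyAt k j′ _ j≤k))))
    where
    byFirstPart : ∀ q →
      shift (suc q) (λ m → total (λ c → runsFrom j prev (suc q ∷ c)) (compositions m k)) (suc n)
        ≡ shift (suc q) A (suc n) + onlyAt j′ q (shift j Y (suc n))
    byFirstPart q with q ≟ j′
    ... | yes refl = trans (shift-cong j (suc n) first-j) (cut-+ j (suc n) _ _)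
    ... | no  q≢j′ =
      trans (shift-cong (suc q) (suc n) (λ m → total-cong (compositions m k)
              (λ c → runs-other prev (suc q) c (λ sq≡j → q≢j′ (ℕP.suc-injective sq≡j)))))
            (sym (ℤP.+-identityʳ _))

  -- A leading j starts a run and the rest behaves as after a j.
  A-rec : ∀ n → A n ≡ lag k A n + shift j (λ m → count m + B m - A m) n
  A-rec = runTotal-rec 0 _ (λ m →
    trans (total-cong (compositions m k) runs-new)
    (trans (total-suc (runsFrom j j) (compositions m k)) (regroup (count m) (B m) (A m))))
    where
    regroup : ∀ c b a → c + b ≡ a + (c + b - a)
    regroup = solve-∀

  -- After a j, a further j continues the current run.
  B-rec : ∀ n → B n ≡ lag k A n + shift j (λ m → B m - A m) n
  B-rec = runTotal-rec j _ (λ m →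
    trans (total-cong (compositions m k) runs-continue) (regroup (B m) (A m)))
    where
    regroup : ∀ b a → b ≡ a + (b - a)
    regroup = solve-∀

  A-B : ∀ n → A n - B n ≡ shift j count n
  A-B n =
    trans (cong₂ _-_ (A-rec n) (B-rec n))
    (trans (cancel (lag k A n) _ _)
    (trans (sym (cut-- j n _ _)) (shift-cong j n (λ m → difference (count m) (B m) (A m)))))
    where
    cancel : ∀ l x y → l + x - (l + y) ≡ x - y
    cancel = solve-∀
    difference : ∀ c b a → c + b - a - (b - a) ≡ c
    difference = solve-∀

  -- Substituting B = A - x^j count into A-rec gives a closed recurrence.
  A-closed : ∀ n → A n ≡ lag k A n + (shift j count n - shift (j ℕ.+ j) count n)
  A-closed n =
    trans (A-rec n) (cong (lag k A n +_)
    (trans (shift-cong j n (λ m → regroup (count m) (B m) (A m)))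
    (trans (cut-- j n _ _) (cong (shift j count n -_)
    (trans (shift-cong j n A-B) (shift-shift j j count n))))))
    where
    regroup : ∀ c b a → c + b - a ≡ c - (a - b)
    regroup = solve-∀

  closedForm : ℕ → ℤ
  closedForm n = shift j fib² n - shift (j ℕ.+ j) fib² n

  shift-fib²-rec : ∀ d n → shift d fib² n ≡ lag k (shift d fib²) n + shift d count n
  shift-fib²-rec d n =
    trans (shift-cong d n fib²-rec)
    (trans (cut-+ d n _ _)
           (cong₂ _+_ (shift-lag k d fib² n) (shift-cong d n (λ m → sym (count≡fib m)))))

  closedForm-rec : ∀ n →
    closedForm n ≡ lag k closedForm n + (shift j count n - shift (j ℕ.+ j) count n)
  closedForm-rec n =
    trans (cong₂ _-_ (shift-fib²-rec j n) (shift-fib²-rec (j ℕ.+ j) n))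
    (trans (regroup (lag k (shift j fib²) n) _ (lag k (shift (j ℕ.+ j) fib²) n) _)
           (cong (_+ (shift j count n - shift (j ℕ.+ j) count n))
                 (sym (lag-- k (shift j fib²) (shift (j ℕ.+ j) fib²) n))))
    where
    regroup : ∀ a b c d → a + b - (c + d) ≡ a - c + (b - d)
    regroup = solve-∀

  A≡closedForm : ∀ n → A n ≡ closedForm n
  A≡closedForm = recurrence-unique k _ A closedForm A-closed closedForm-rec

open import Data.Nat using (_+_; _*_; _∸_; z≤n; s≤s)
open import Data.Nat.Properties using (+-identityʳ)
open import Data.Integer using (+_; _-_)
open import Relation.Binary.PropositionalEquality using (_≡_; cong; cong₂; sym)
open Relation.Binary.PropositionalEquality.≡-Reasoning
open Sequences using (shift)
open CompositionTotals using (total-sum)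

mainTheorem10 : (n j k : ℕ) → 1 ≤ j → j ≤ k → k ≤ n →
    + r n j k ≡ + F3 k 1 (n + 1 ∸ j) - + F3 k 1 (n + 1 ∸ 2 * j)
mainTheorem10 n (suc j′) k (s≤s z≤n) j≤k _ = begin
  + r n j k                                   ≡⟨ total-sum (runs j) (compositions n k) ⟩
  A n                                         ≡⟨ A≡closedForm n ⟩
  shift j fib² n - shift (j + j) fib² n       ≡⟨ cong (λ d → shift j fib² n - shift d fib² n) j+j≡2*j ⟩
  shift j fib² n - shift (2 * j) fib² n       ≡⟨ cong₂ _-_ (shift-fib² j n) (shift-fib² (2 * j) n) ⟩
  + F3 k 1 (n + 1 ∸ j) - + F3 k 1 (n + 1 ∸ 2 * j) ∎
  where
  open KBonacci k using (fib²; shift-fib²)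
  open RunsOfJ k j′ j≤k using (j; A; A≡closedForm)

  j+j≡2*j : j + j ≡ 2 * j
  j+j≡2*j = cong (λ x → j + x) (sym (+-identityʳ j))
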